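{- Let $G$ be a $2$-connected graph, let $\overrightarrow{C}$ be a longest cycle of $G$ with a fixed orientation, and let $H$ be a component of $G-V(C)$. Let $x\in V(H)$ and $u\in N_G(x;C)$. If $G$ is $\{K_{1,3}^{**},K_3\}$-free and $|V(H)|\ge 2$, then $E(G)\cap\{u^{+2}u^{ - },u^{+2}x\}\ne\emptyset$ and $E(G)\cap\{u^{ -2}u^{+},u^{ -2}x\}\ne\emptyset$.
   Context: $N_G(x;C)=N_G(x)\cap V(C)$. For $u$ on the oriented cycle $\overrightarrow{C}$, $u^{+h}$ and $u^{ -h}$ denote the $h$-th successor and $h$-th predecessor of $u$ along $\overrightarrow{C}$, with $u^{+}=u^{+1}$, $u^{ - }=u^{ -1}$. $G$ is $\{K_{1,3}^{**},K_3\}$-free if it contains neither $K_{1,3}^{**}$ nor a triangle as an induced subgraph, where $K_{1,3}^{**}$ is obtained from the claw $K_{1,3}$ by subdividing each edge once and then deleting one vertex of degree $1$. -}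

module Defs where

open import Data.Nat using (ℕ; zero; suc; _+_; _*_; _∸_; _≤_)
open import Data.Nat.DivMod using (_mod_)
open import Data.Fin using (Fin; toℕ)
open import Data.Product using (Σ; ∃; _×_; _,_)
open import Data.Sum using (_⊎_)
open import Data.Unit using (⊤)
open import Relation.Nullary using (¬_; Dec)
open import Relation.Binary.PropositionalEquality using (_≡_; _≢_)
open import Function.Bundles using (_⇔_)
open import Function.Definitions using (Injective)

record Graph : Set₁ where
  field
    n      : ℕ
    Adj    : Fin n → Fin n → Set
    sym    : ∀ {x y} → Adj x y → Adj y x
    irrefl : ∀ {x} → ¬ Adj x x
    dec    : ∀ x y → Dec (Adj x y)

open Graph public

Vertex : Graph → Set
Vertex G = Fin (n G)

-- Reach G A x y : there is a path from x to y in the subgraph of G induced by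
-- the vertices satisfying A.
data Reach (G : Graph) (A : Vertex G → Set) : Vertex G → Vertex G → Set where
  here : ∀ {x} → A x → Reach G A x x
  step : ∀ {x z y} → A x → Adj G x z → Reach G A z y → Reach G A x y


Connected : Graph → Set
Connected G = ∀ x y → Reach G (λ _ → ⊤) x y

TwoConnected : Graph → Set
TwoConnected G =
  (3 ≤ n G) × Connected G ×
  (∀ (v x y : Vertex G) → x ≢ v → y ≢ v → Reach G (λ w → w ≢ v) x y)

-- A cycle of length  3 + m  with a fixed orientation given by the indexing:
-- vertices vtx 0, vtx 1, ..., vtx (len-1), consecutive ones adjacent (cyclically).
record Cycle (G : Graph) : Set where
  field
    m     : ℕ
    vtx   : Fin (3 + m) → Vertex G
    inj   : Injective _≡_ _≡_ vtx
    edges : ∀ (i : Fin (3 + m)) → Adj G (vtx i) (vtx (((toℕ i) + 1) mod (3 + m)))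

open Cycle public

len : ∀ {G} → Cycle G → ℕ
len C = 3 + m C

_⊕[_]_ : ∀ {G} → (C : Cycle G) → Fin (3 + m C) → ℕ → Fin (3 + m C)
_⊕[_]_ C i h = (toℕ i + h) mod (3 + m C)

-- position i shifted backward by h (h * (len - 1) ≡ - h  mod len)
_⊖[_]_ : ∀ {G} → (C : Cycle G) → Fin (3 + m C) → ℕ → Fin (3 + m C)
_⊖[_]_ C i h = (toℕ i + h * (2 + m C)) mod (3 + m C)

succ^ : ∀ {G} (C : Cycle G) → Fin (3 + m C) → ℕ → Vertex G
succ^ C i h = vtx C (C ⊕[ i ] h)

pred^ : ∀ {G} (C : Cycle G) → Fin (3 + m C) → ℕ → Vertex G
pred^ C i h = vtx C (C ⊖[ i ] h)

OnCycle : ∀ {G} → Cycle G → Vertex G → Set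
OnCycle C w = ∃ λ i → vtx C i ≡ w

LongestCycle : ∀ {G} → Cycle G → Set
LongestCycle {G} C = ∀ (D : Cycle G) → len D ≤ len C

-- vertex set of the component of G - V(C) containing x
InComponentOf : ∀ {G} → Cycle G → Vertex G → Vertex G → Set
InComponentOf {G} C x y = Reach G (λ w → ¬ OnCycle C w) x y

record InducedCopy (k : ℕ) (E : Fin k → Fin k → Set) (G : Graph) : Set where
  field
    f     : Fin k → Vertex G
    finj  : Injective _≡_ _≡_ f
    faith : ∀ i j → E i j ⇔ Adj G (f i) (f j)

K3E : Fin 3 → Fin 3 → Set
K3E i j = i ≢ j

-- K_{1,3}^{**}: vertices 0 = centre c, 1,2,3 = b1,b2,b3 (subdivision vertices),
-- 4 = a1, 5 = a2 (leaves; the third leaf a3 deleted).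
-- edges: c-b1, c-b2, c-b3, b1-a1, b2-a2.
data K13E : Fin 6 → Fin 6 → Set where
  e01 : K13E Fin.zero (Fin.suc Fin.zero)
  e10 : K13E (Fin.suc Fin.zero) Fin.zero
  e02 : K13E Fin.zero (Fin.suc (Fin.suc Fin.zero))
  e20 : K13E (Fin.suc (Fin.suc Fin.zero)) Fin.zero
  e03 : K13E Fin.zero (Fin.suc (Fin.suc (Fin.suc Fin.zero)))
  e30 : K13E (Fin.suc (Fin.suc (Fin.suc Fin.zero))) Fin.zero
  e14 : K13E (Fin.suc Fin.zero) (Fin.suc (Fin.suc (Fin.suc (Fin.suc Fin.zero))))
  e41 : K13E (Fin.suc (Fin.suc (Fin.suc (Fin.suc Fin.zero)))) (Fin.suc Fin.zero)
  e25 : K13E (Fin.suc (Fin.suc Fin.zero)) (Fin.suc (Fin.suc (Fin.suc (Fin.suc (Fin.suc Fin.zero)))))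
  e52 : K13E (Fin.suc (Fin.suc (Fin.suc (Fin.suc (Fin.suc Fin.zero))))) (Fin.suc (Fin.suc Fin.zero))

K13FreeK3Free : Graph → Set
K13FreeK3Free G = ¬ InducedCopy 6 K13E G × ¬ InducedCopy 3 K3E G

module Submission where

-- Write u = vtx C i and let y be a neighbour of x in H (it exists
-- because |V(H)| ≥ 2).  Maximality of C forbids every "detour" that replaces a
-- segment of C with d interior vertices by a path of more than d vertices off C.
-- Hence x is adjacent to neither u⁺ nor u⁻, and y to none of u⁻², u⁻, u⁺, u⁺².
-- Triangle-freeness forces |C| ≥ 4 and u ≁ y, u ≁ u^{±2}, u⁺ ≁ u⁻.  If now
-- u⁺² were adjacent to neither u⁻ nor x, the vertices u; x, u⁺, u⁻; y, u⁺²
-- would induce K_{1,3}^{**}.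

open import Defs
open import Data.Nat using (ℕ; zero; suc; _+_; _*_; _∸_; _≤_; _<_; _<?_; s≤s; z≤n)
open import Data.Nat.Properties
open import Data.Nat.DivMod
open import Data.Nat.Tactic.RingSolver using (solve-∀)
open import Data.Fin using (Fin; toℕ; zero; suc) renaming (_≟_ to _≟ᶠ_)
open import Data.Fin.Properties using (toℕ-injective; toℕ-fromℕ<; toℕ<n)
open import Data.Product using (∃; _×_; _,_; proj₁; proj₂)
open import Data.Sum using (_⊎_; inj₁; inj₂)
open import Data.Empty using (⊥; ⊥-elim)
open import Relation.Nullary using (¬_; yes; no)
open import Function.Bundles using (_⇔_; mk⇔; module Equivalence)
open import Relation.Binary.PropositionalEquality
  using (_≡_; _≢_; refl; trans; cong; subst; subst₂; module ≡-Reasoning)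
  renaming (sym to ≡-sym)

open Equivalence using (to; from)

-- A pattern graph is twin-free when no two distinct vertices have the same
-- neighbourhood; maps faithful to such a pattern are automatically injective.
TwinFree : ∀ {k} → (Fin k → Fin k → Set) → Set
TwinFree {k} E = ∀ i j → (∀ l → E i l ⇔ E j l) → i ≡ j

sameImage⇒sameRow : ∀ {G k} {E : Fin k → Fin k → Set} (v : Fin k → Vertex G) →
  (∀ i j → E i j ⇔ Adj G (v i) (v j)) →
  ∀ {i j} → v i ≡ v j → ∀ l → E i l ⇔ E j l
sameImage⇒sameRow {G} v faith {i} {j} vi≡vj l = mk⇔
  (λ e → from (faith j l) (subst (λ w → Adj G w (v l)) vi≡vj (to (faith i l) e)))
  (λ e → from (faith i l) (subst (λ w → Adj G w (v l)) (≡-sym vi≡vj) (to (faith j l) e)))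

inducedCopy : ∀ {G k} {E : Fin k → Fin k → Set} (v : Fin k → Vertex G) →
  (∀ i j → E i j ⇔ Adj G (v i) (v j)) → TwinFree E → InducedCopy k E G
inducedCopy {G} v faith twinFree = record
  { f = v
  ; finj = λ {i} {j} vi≡vj → twinFree i j (sameImage⇒sameRow {G} v faith vi≡vj)
  ; faith = faith }

K3-twinFree : TwinFree K3E
K3-twinFree i j sameRow with i ≟ᶠ j
... | yes i≡j = i≡j
... | no i≢j = ⊥-elim (to (sameRow j) i≢j refl)

pattern centre = zero
pattern mid₁ = suc zero
pattern mid₂ = suc (suc zero)
pattern mid₃ = suc (suc (suc zero))
pattern leaf₁ = suc (suc (suc (suc zero)))
pattern leaf₂ = suc (suc (suc (suc (suc zero))))

-- Each vertex is recognised by one of its neighbours, up to a second check.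
K13-twinFree : TwinFree K13E
K13-twinFree centre j sameRow with to (sameRow mid₃) e03
... | e03 = refl
K13-twinFree mid₁ j sameRow with to (sameRow leaf₁) e14
... | e14 = refl
K13-twinFree mid₂ j sameRow with to (sameRow leaf₂) e25
... | e25 = refl
K13-twinFree mid₃ j sameRow with to (sameRow centre) e30
... | e30 = refl
... | e10 with from (sameRow leaf₁) e14
...   | ()
K13-twinFree mid₃ j sameRow | e20 with from (sameRow leaf₂) e25
...   | ()
K13-twinFree leaf₁ j sameRow with to (sameRow mid₁) e41
... | e41 = refl
... | e01 with from (sameRow mid₂) e02
...   | ()
K13-twinFree leaf₂ j sameRow with to (sameRow mid₂) e52
... | e52 = refl
... | e02 with from (sameRow mid₁) e01
...   | ()

noTriangle : ∀ {G} → ¬ InducedCopy 3 K3E G →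
  ∀ {a b d} → Adj G a b → Adj G b d → Adj G a d → ⊥
noTriangle {G} noK3 {a} {b} {d} ab bd ad = noK3 (inducedCopy v faith K3-twinFree)
  where
  v : Fin 3 → Vertex G
  v zero = a
  v (suc zero) = b
  v (suc (suc zero)) = d

  distinct⇒adjacent : ∀ i j → i ≢ j → Adj G (v i) (v j)
  distinct⇒adjacent zero zero i≢j = ⊥-elim (i≢j refl)
  distinct⇒adjacent zero (suc zero) _ = ab
  distinct⇒adjacent zero (suc (suc zero)) _ = ad
  distinct⇒adjacent (suc zero) zero _ = sym G ab
  distinct⇒adjacent (suc zero) (suc zero) i≢j = ⊥-elim (i≢j refl)
  distinct⇒adjacent (suc zero) (suc (suc zero)) _ = bd
  distinct⇒adjacent (suc (suc zero)) zero _ = sym G ad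
  distinct⇒adjacent (suc (suc zero)) (suc zero) _ = sym G bd
  distinct⇒adjacent (suc (suc zero)) (suc (suc zero)) i≢j = ⊥-elim (i≢j refl)

  faith : ∀ i j → K3E i j ⇔ Adj G (v i) (v j)
  faith i j = mk⇔ (distinct⇒adjacent i j)
    (λ vivj i≡j → irrefl G (subst (λ l → Adj G (v i) (v l)) (≡-sym i≡j) vivj))

noK13** : ∀ {G} → ¬ InducedCopy 6 K13E G → (c b₁ b₂ b₃ a₁ a₂ : Vertex G) →
  Adj G c b₁ → Adj G c b₂ → Adj G c b₃ → Adj G b₁ a₁ → Adj G b₂ a₂ →
  ¬ Adj G c a₁ → ¬ Adj G c a₂ → ¬ Adj G b₁ b₂ → ¬ Adj G b₁ b₃ → ¬ Adj G b₁ a₂ →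
  ¬ Adj G b₂ b₃ → ¬ Adj G b₂ a₁ → ¬ Adj G b₃ a₁ → ¬ Adj G b₃ a₂ → ¬ Adj G a₁ a₂ → ⊥
noK13** {G} noK13 c b₁ b₂ b₃ a₁ a₂ cb₁ cb₂ cb₃ b₁a₁ b₂a₂
    ¬ca₁ ¬ca₂ ¬b₁b₂ ¬b₁b₃ ¬b₁a₂ ¬b₂b₃ ¬b₂a₁ ¬b₃a₁ ¬b₃a₂ ¬a₁a₂ =
  noK13 (inducedCopy v (λ i j → mk⇔ (preserve i j) (reflect i j)) K13-twinFree)
  where
  v : Fin 6 → Vertex G
  v centre = c
  v mid₁ = b₁
  v mid₂ = b₂
  v mid₃ = b₃
  v leaf₁ = a₁
  v leaf₂ = a₂

  preserve : ∀ i j → K13E i j → Adj G (v i) (v j)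
  preserve _ _ e01 = cb₁
  preserve _ _ e10 = sym G cb₁
  preserve _ _ e02 = cb₂
  preserve _ _ e20 = sym G cb₂
  preserve _ _ e03 = cb₃
  preserve _ _ e30 = sym G cb₃
  preserve _ _ e14 = b₁a₁
  preserve _ _ e41 = sym G b₁a₁
  preserve _ _ e25 = b₂a₂
  preserve _ _ e52 = sym G b₂a₂

  reflect : ∀ i j → Adj G (v i) (v j) → K13E i j
  reflect centre centre a = ⊥-elim (irrefl G a)
  reflect centre mid₁ _ = e01
  reflect centre mid₂ _ = e02
  reflect centre mid₃ _ = e03
  reflect centre leaf₁ a = ⊥-elim (¬ca₁ a)
  reflect centre leaf₂ a = ⊥-elim (¬ca₂ a)
  reflect mid₁ centre _ = e10
  reflect mid₁ mid₁ a = ⊥-elim (irrefl G a)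
  reflect mid₁ mid₂ a = ⊥-elim (¬b₁b₂ a)
  reflect mid₁ mid₃ a = ⊥-elim (¬b₁b₃ a)
  reflect mid₁ leaf₁ _ = e14
  reflect mid₁ leaf₂ a = ⊥-elim (¬b₁a₂ a)
  reflect mid₂ centre _ = e20
  reflect mid₂ mid₁ a = ⊥-elim (¬b₁b₂ (sym G a))
  reflect mid₂ mid₂ a = ⊥-elim (irrefl G a)
  reflect mid₂ mid₃ a = ⊥-elim (¬b₂b₃ a)
  reflect mid₂ leaf₁ a = ⊥-elim (¬b₂a₁ a)
  reflect mid₂ leaf₂ _ = e25
  reflect mid₃ centre _ = e30
  reflect mid₃ mid₁ a = ⊥-elim (¬b₁b₃ (sym G a))
  reflect mid₃ mid₂ a = ⊥-elim (¬b₂b₃ (sym G a))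
  reflect mid₃ mid₃ a = ⊥-elim (irrefl G a)
  reflect mid₃ leaf₁ a = ⊥-elim (¬b₃a₁ a)
  reflect mid₃ leaf₂ a = ⊥-elim (¬b₃a₂ a)
  reflect leaf₁ centre a = ⊥-elim (¬ca₁ (sym G a))
  reflect leaf₁ mid₁ _ = e41
  reflect leaf₁ mid₂ a = ⊥-elim (¬b₂a₁ (sym G a))
  reflect leaf₁ mid₃ a = ⊥-elim (¬b₃a₁ (sym G a))
  reflect leaf₁ leaf₁ a = ⊥-elim (irrefl G a)
  reflect leaf₁ leaf₂ a = ⊥-elim (¬a₁a₂ a)
  reflect leaf₂ centre a = ⊥-elim (¬ca₂ (sym G a))
  reflect leaf₂ mid₁ a = ⊥-elim (¬b₁a₂ (sym G a))
  reflect leaf₂ mid₂ _ = e52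
  reflect leaf₂ mid₃ a = ⊥-elim (¬b₃a₂ (sym G a))
  reflect leaf₂ leaf₁ a = ⊥-elim (¬a₁a₂ (sym G a))
  reflect leaf₂ leaf₂ a = ⊥-elim (irrefl G a)

-- If x and y see neither a nor a', and y ≁ b, then b sees
-- a' or x: otherwise u; x, a, a'; y, b induce K_{1,3}^{**}.
clawLemma : ∀ {G} → K13FreeK3Free G → ∀ {u x y a b a'} →
  Adj G u x → Adj G x y → Adj G u a → Adj G a b → Adj G u a' →
  ¬ Adj G x a → ¬ Adj G x a' → ¬ Adj G y a → ¬ Adj G y a' → ¬ Adj G y b →
  Adj G b a' ⊎ Adj G b x
clawLemma {G} (noK13 , noK3) {u} {x} {y} {a} {b} {a'} ux xy ua ab ua' ¬xa ¬xa' ¬ya ¬ya' ¬yb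
  with dec G b a' | dec G b x
... | yes ba' | _ = inj₁ ba'
... | no _ | yes bx = inj₂ bx
... | no ¬ba' | no ¬bx = ⊥-elim (noK13** noK13 u x a a' y b ux ua ua' xy ab
        (noTriangle noK3 ux xy) (noTriangle noK3 ua ab)
        ¬xa ¬xa' (λ xb → ¬bx (sym G xb)) (noTriangle noK3 (sym G ua) ua')
        (λ ay → ¬ya (sym G ay)) (λ a'y → ¬ya' (sym G a'y))
        (λ a'b → ¬ba' (sym G a'b)) ¬yb)

+-exchange : ∀ a b c → a + (b + c) ≡ b + (a + c)
+-exchange = solve-∀

sequenceCycle : ∀ {G} (m' : ℕ) (f : ℕ → Vertex G) →
  (∀ t → suc t < 3 + m' → Adj G (f t) (f (suc t))) → Adj G (f (2 + m')) (f 0) →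
  (∀ s t → s < 3 + m' → t < 3 + m' → f s ≡ f t → s ≡ t) → Cycle G
sequenceCycle {G} m' f consecutive close distinct = record
  { m = m'
  ; vtx = λ i → f (toℕ i)
  ; inj = λ {i} {j} same → toℕ-injective (distinct (toℕ i) (toℕ j) (toℕ<n i) (toℕ<n j) same)
  ; edges = edge }
  where
  n' = 3 + m'

  toℕ-next : ∀ (i : Fin n') → toℕ ((toℕ i + 1) mod n') ≡ (toℕ i + 1) % n'
  toℕ-next i = toℕ-fromℕ< (m%n<n (toℕ i + 1) n')

  edge : ∀ (i : Fin n') → Adj G (f (toℕ i)) (f (toℕ ((toℕ i + 1) mod n')))
  edge i with toℕ i + 1 <? n'
  ... | yes i+1<n' = subst (λ z → Adj G (f (toℕ i)) (f z)) (≡-sym next≡i+1)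
          (consecutive (toℕ i) (subst (_< n') (+-comm (toℕ i) 1) i+1<n'))
    where
    next≡i+1 : toℕ ((toℕ i + 1) mod n') ≡ suc (toℕ i)
    next≡i+1 = trans (toℕ-next i) (trans (m<n⇒m%n≡m i+1<n') (+-comm (toℕ i) 1))
  ... | no i+1≮n' = subst₂ (λ a b → Adj G (f a) (f b)) (≡-sym i≡last) (≡-sym next≡0) close
    where
    i+1≡n' : toℕ i + 1 ≡ n'
    i+1≡n' = ≤-antisym (subst (_≤ n') (+-comm 1 (toℕ i)) (toℕ<n i)) (≮⇒≥ i+1≮n')
    i≡last : toℕ i ≡ 2 + m'
    i≡last = trans (≡-sym (m+n∸n≡m (toℕ i) 1)) (cong (_∸ 1) i+1≡n')
    next≡0 : toℕ ((toℕ i + 1) mod n') ≡ 0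
    next≡0 = trans (toℕ-next i) (trans (cong (_% n') i+1≡n') (n%n≡0 n'))

module CycleSequence {G : Graph} (C : Cycle G) where

  L : ℕ
  L = len C

  at : ℕ → Vertex G
  at a = vtx C (a mod L)

  toℕ-mod : ∀ a → toℕ (a mod L) ≡ a % L
  toℕ-mod a = toℕ-fromℕ< (m%n<n a L)

  at-cong : ∀ {a b} → a % L ≡ b % L → at a ≡ at b
  at-cong {a} {b} a≡b = cong (vtx C) (toℕ-injective
    (trans (toℕ-mod a) (trans a≡b (≡-sym (toℕ-mod b)))))

  at-toℕ : ∀ i → at (toℕ i) ≡ vtx C i
  at-toℕ i = cong (vtx C) (toℕ-injective (trans (toℕ-mod (toℕ i)) (m<n⇒m%n≡m (toℕ<n i))))

  at-periodic : ∀ a b → b ≡ a + L → at b ≡ at a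
  at-periodic a b b≡a+L = at-cong {b} {a} (trans (cong (_% L) b≡a+L) ([m+n]%n≡m%n a L))

  at-onCycle : ∀ a → OnCycle C (at a)
  at-onCycle a = a mod L , refl

  %-absorbˡ : ∀ a b → (a % L + b) % L ≡ (a + b) % L
  %-absorbˡ a b = begin
      (a % L + b) % L         ≡⟨ %-distribˡ-+ (a % L) b L ⟩
      (a % L % L + b % L) % L ≡⟨ cong (λ z → (z + b % L) % L) (m%n%n≡m%n a L) ⟩
      (a % L + b % L) % L     ≡⟨ ≡-sym (%-distribˡ-+ a b L) ⟩
      (a + b) % L             ∎
    where open ≡-Reasoning

  at-step : ∀ a → Adj G (at a) (at (suc a))
  at-step a = subst (λ z → Adj G (at a) (vtx C z)) (at-index-cong) (edges C (a mod L))
    where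
    at-index-cong : (toℕ (a mod L) + 1) mod L ≡ suc a mod L
    at-index-cong = toℕ-injective (trans (toℕ-mod (toℕ (a mod L) + 1))
      (trans (cong (λ z → (z + 1) % L) (toℕ-mod a))
        (trans (%-absorbˡ a 1) (trans (cong (_% L) (+-comm a 1)) (≡-sym (toℕ-mod (suc a)))))))

  +-cong-mod : ∀ z {a b} → a % L ≡ b % L → (z + a) % L ≡ (z + b) % L
  +-cong-mod z {a} {b} a≡b = begin
      (z + a) % L             ≡⟨ %-distribˡ-+ z a L ⟩
      (z % L + a % L) % L     ≡⟨ cong (λ w → (z % L + w) % L) a≡b ⟩
      (z % L + b % L) % L     ≡⟨ ≡-sym (%-distribˡ-+ z b L) ⟩
      (z + b) % L             ∎
    where open ≡-Reasoning

  unshift : ∀ p a → (L ∸ p % L + (p + a)) % L ≡ a % L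
  unshift p a = begin
      (L ∸ r + (p + a)) % L   ≡⟨ +-cong-mod (L ∸ r) (≡-sym (%-absorbˡ p a)) ⟩
      (L ∸ r + (r + a)) % L   ≡⟨ cong (_% L) (≡-sym (+-assoc (L ∸ r) r a)) ⟩
      (L ∸ r + r + a) % L     ≡⟨ cong (λ z → (z + a) % L) (m∸n+n≡m (m%n≤n p L)) ⟩
      (L + a) % L             ≡⟨ cong (_% L) (+-comm L a) ⟩
      (a + L) % L             ≡⟨ [m+n]%n≡m%n a L ⟩
      a % L                   ∎
    where
    r = p % L
    open ≡-Reasoning

  at-shift-injective : ∀ p {a b} → a < L → b < L → at (p + a) ≡ at (p + b) → a ≡ b
  at-shift-injective p {a} {b} a<L b<L same = begin
      a                           ≡⟨ ≡-sym (m<n⇒m%n≡m a<L) ⟩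
      a % L                       ≡⟨ ≡-sym (unshift p a) ⟩
      (L ∸ p % L + (p + a)) % L   ≡⟨ +-cong-mod (L ∸ p % L) p+a≡p+b ⟩
      (L ∸ p % L + (p + b)) % L   ≡⟨ unshift p b ⟩
      b % L                       ≡⟨ m<n⇒m%n≡m b<L ⟩
      b                           ∎
    where
    open ≡-Reasoning
    p+a≡p+b : (p + a) % L ≡ (p + b) % L
    p+a≡p+b = trans (≡-sym (toℕ-mod (p + a))) (trans (cong toℕ (inj C same)) (toℕ-mod (p + b)))

  record OutsidePath (k : ℕ) : Set where
    field
      walk     : ℕ → Vertex G
      adjacent : ∀ t → suc t < k → Adj G (walk t) (walk (suc t))
      distinct : ∀ s t → s < k → t < k → walk s ≡ walk t → s ≡ t
      outside  : ∀ t → t < k → ¬ OnCycle C (walk t)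

  -- Suppose m C ≡ d + r, so that going forward from at (p + 2 + r)
  -- back to at p passes d interior vertices of C.  If a path of k > d vertices
  -- off C leads from at (p + 2 + r) to at p, then
  --   walk 0, …, walk (k ∸ 1), at p, at (p + 1), …, at (p + 2 + r)
  -- is a cycle of length 3 + k + r > len C.
  module Detour (d r : ℕ) (m≡d+r : m C ≡ d + r) (k₀ : ℕ) (d≤k₀ : d ≤ k₀)
    (P : OutsidePath (suc k₀)) (p : ℕ)
    (enter : Adj G (OutsidePath.walk P k₀) (at p))
    (leave : Adj G (at (p + (2 + r))) (OutsidePath.walk P 0)) where

    open OutsidePath P

    k : ℕ
    k = suc k₀

    f : ℕ → Vertex G
    f t with t <? k
    ... | yes _ = walk t
    ... | no _ = at (p + (t ∸ k))

    f-walk : ∀ {t} → t < k → f t ≡ walk t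
    f-walk {t} t<k with t <? k
    ... | yes _ = refl
    ... | no t≮k = ⊥-elim (t≮k t<k)

    f-arc : ∀ {t} → k ≤ t → f t ≡ at (p + (t ∸ k))
    f-arc {t} k≤t with t <? k
    ... | yes t<k = ⊥-elim (<⇒≱ t<k k≤t)
    ... | no _ = refl

    side : ∀ t → t < k ⊎ k ≤ t
    side t with t <? k
    ... | yes t<k = inj₁ t<k
    ... | no t≮k = inj₂ (≮⇒≥ t≮k)

    f-step : ∀ t → Adj G (f t) (f (suc t))
    f-step t with side t | side (suc t)
    ... | inj₁ t<k | inj₁ st<k =
      subst₂ (Adj G) (≡-sym (f-walk t<k)) (≡-sym (f-walk st<k)) (adjacent t st<k)
    ... | inj₁ t<k | inj₂ k≤st =
      subst₂ (Adj G) (≡-sym (trans (f-walk t<k) (cong walk t≡k₀)))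
        (≡-sym (trans (f-arc k≤st) (cong (λ z → at (p + (z ∸ k))) st≡k)))
        (subst (λ z → Adj G (walk k₀) (at z)) (≡-sym (trans (cong (p +_) (n∸n≡0 k)) (+-identityʳ p))) enter)
      where
      st≡k : suc t ≡ k
      st≡k = ≤-antisym t<k k≤st
      t≡k₀ : t ≡ k₀
      t≡k₀ = suc-injective st≡k
    ... | inj₂ k≤t | inj₁ st<k = ⊥-elim (<⇒≱ st<k (≤-trans k≤t (n≤1+n t)))
    ... | inj₂ k≤t | inj₂ k≤st =
      subst₂ (Adj G) (≡-sym (f-arc k≤t)) (≡-sym (trans (f-arc k≤st) (cong at shift)))
        (at-step (p + (t ∸ k)))
      where
      shift : p + (suc t ∸ k) ≡ suc (p + (t ∸ k))
      shift = trans (cong (p +_) (+-∸-assoc 1 k≤t)) (+-suc p (t ∸ k))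

    m' : ℕ
    m' = k + r

    f-close : Adj G (f (2 + m')) (f 0)
    f-close = subst₂ (Adj G)
      (≡-sym (trans (f-arc k≤end) (cong (λ z → at (p + z)) end∸k)))
      (≡-sym (f-walk (s≤s z≤n))) leave
      where
      k≤end : k ≤ 2 + m'
      k≤end = ≤-trans (m≤m+n k r) (m≤n+m (k + r) 2)
      end∸k : 2 + (k + r) ∸ k ≡ 2 + r
      end∸k = trans (cong (_∸ k) (+-exchange 2 k r))
                    (m+n∸m≡n k (2 + r))

    arc-bound : ∀ t → t < 3 + m' → t ∸ k < L
    arc-bound t t<end = ≤-trans (m<n+o⇒m∸n<o t k (subst (t <_) (+-exchange 3 k r) t<end))
      (subst (3 + r ≤_) (cong (3 +_) (≡-sym m≡d+r)) (+-monoʳ-≤ 3 (m≤n+m r d)))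

    f-injective : ∀ s t → s < 3 + m' → t < 3 + m' → f s ≡ f t → s ≡ t
    f-injective s t s<end t<end fs≡ft with side s | side t
    ... | inj₁ s<k | inj₁ t<k =
      distinct s t s<k t<k (trans (≡-sym (f-walk s<k)) (trans fs≡ft (f-walk t<k)))
    ... | inj₁ s<k | inj₂ k≤t = ⊥-elim (outside s s<k
      (subst (OnCycle C) (trans (≡-sym (f-arc k≤t)) (trans (≡-sym fs≡ft) (f-walk s<k)))
        (at-onCycle (p + (t ∸ k)))))
    ... | inj₂ k≤s | inj₁ t<k = ⊥-elim (outside t t<k
      (subst (OnCycle C) (trans (≡-sym (f-arc k≤s)) (trans fs≡ft (f-walk t<k)))
        (at-onCycle (p + (s ∸ k)))))
    ... | inj₂ k≤s | inj₂ k≤t = begin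
        s             ≡⟨ ≡-sym (m∸n+n≡m k≤s) ⟩
        s ∸ k + k     ≡⟨ cong (_+ k) (at-shift-injective p (arc-bound s s<end) (arc-bound t t<end)
                           (trans (≡-sym (f-arc k≤s)) (trans fs≡ft (f-arc k≤t)))) ⟩
        t ∸ k + k     ≡⟨ m∸n+n≡m k≤t ⟩
        t             ∎
      where open ≡-Reasoning

    detourCycle : Cycle G
    detourCycle = sequenceCycle m' f (λ t _ → f-step t) f-close f-injective

    notLongest : ¬ LongestCycle C
    notLongest longest = <⇒≱ (s≤s d≤k₀)
      (+-cancelʳ-≤ r k d (subst (k + r ≤_) m≡d+r (+-cancelˡ-≤ 3 _ _ (longest detourCycle))))

  singlePath : ∀ {x} → ¬ OnCycle C x → OutsidePath 1
  singlePath {x} x∉C = record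
    { walk = λ _ → x
    ; adjacent = λ { _ (s≤s ()) }
    ; distinct = λ { zero zero _ _ _ → refl ; (suc _) _ (s≤s ()) _ _ ; zero (suc _) _ (s≤s ()) _ }
    ; outside = λ _ _ → x∉C }

  edgePath : ∀ {x y} → ¬ OnCycle C x → ¬ OnCycle C y → Adj G x y → OutsidePath 2
  edgePath {x} {y} x∉C y∉C xy = record
    { walk = walk
    ; adjacent = λ { zero _ → xy ; (suc _) (s≤s (s≤s ())) }
    ; distinct = distinct
    ; outside = λ { zero _ → x∉C ; (suc _) _ → y∉C } }
    where
    walk : ℕ → Vertex G
    walk zero = x
    walk (suc _) = y

    x≢y : x ≢ y
    x≢y x≡y = irrefl G (subst (Adj G x) (≡-sym x≡y) xy)

    distinct : ∀ s t → s < 2 → t < 2 → walk s ≡ walk t → s ≡ t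
    distinct zero zero _ _ _ = refl
    distinct (suc zero) (suc zero) _ _ _ = refl
    distinct zero (suc zero) _ _ x≡y = ⊥-elim (x≢y x≡y)
    distinct (suc zero) zero _ _ y≡x = ⊥-elim (x≢y (≡-sym y≡x))
    distinct (suc (suc _)) _ (s≤s (s≤s ())) _ _
    distinct _ (suc (suc _)) _ (s≤s (s≤s ())) _

  noBridge₁ : LongestCycle C → ∀ {k₀} (P : OutsidePath (suc k₀)) p →
    Adj G (at p) (OutsidePath.walk P 0) → Adj G (OutsidePath.walk P k₀) (at (suc p)) → ⊥
  noBridge₁ longest {k₀} P p leave enter =
    Detour.notLongest 0 (m C) refl k₀ z≤n P (suc p) enter
      (subst (λ v → Adj G v (OutsidePath.walk P 0))
        (≡-sym (at-periodic p (suc p + (2 + m C)) (≡-sym (+-suc p (2 + m C))))) leave)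
      longest

  noBridge₂ : LongestCycle C → ∀ {r} → m C ≡ suc r → ∀ {k₀} (P : OutsidePath (2 + k₀)) p →
    Adj G (at p) (OutsidePath.walk P 0) → Adj G (OutsidePath.walk P (suc k₀)) (at (2 + p)) → ⊥
  noBridge₂ longest {r} m≡1+r {k₀} P p leave enter =
    Detour.notLongest 1 r m≡1+r (suc k₀) (s≤s z≤n) P (2 + p) enter
      (subst (λ v → Adj G v (OutsidePath.walk P 0))
        (≡-sym (at-periodic p (2 + p + (2 + r)) (trans (+-exchange 2 p (2 + r))
          (cong (λ z → p + (3 + z)) (≡-sym m≡1+r))))) leave)
      longest

  length≥4 : ¬ InducedCopy 3 K3E G → ∃ λ r → m C ≡ suc r
  length≥4 noK3 with m C in m≡0
  ... | suc r = r , refl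
  ... | zero = ⊥-elim (noTriangle noK3 (at-step 0) (at-step 1)
        (sym G (subst (Adj G (at 2)) (at-periodic 0 3 (cong (3 +_) (≡-sym m≡0))) (at-step 2))))

  -- Let x ~ y be off the longest cycle C, with x ~ u = at (2 + q).
  -- Then u⁺² ~ u⁻ or u⁺² ~ x, and u⁻² ~ u⁺ or u⁻² ~ x: apply the claw lemma to
  -- the non-adjacencies forced by maximality of C.
  window : K13FreeK3Free G → LongestCycle C → ∀ {x y} → ¬ OnCycle C x → ¬ OnCycle C y →
    Adj G x y → ∀ q → Adj G x (at (2 + q)) →
    (Adj G (at (4 + q)) (at (1 + q)) ⊎ Adj G (at (4 + q)) x) ×
    (Adj G (at q) (at (3 + q)) ⊎ Adj G (at q) x)
  window free@(_ , noK3) longest {x} {y} x∉C y∉C xy q xu =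
    clawLemma free ux xy uu⁺ (at-step (3 + q)) uu⁻ x≁u⁺ x≁u⁻ y≁u⁺ y≁u⁻ y≁u⁺² ,
    clawLemma free ux xy uu⁻ (sym G (at-step q)) uu⁺ x≁u⁻ x≁u⁺ y≁u⁻ y≁u⁺ y≁u⁻²
    where
    ux = sym G xu
    uu⁺ = at-step (2 + q)
    uu⁻ = sym G (at-step (1 + q))
    xy-path = edgePath x∉C y∉C xy
    yx-path = edgePath y∉C x∉C (sym G xy)
    m≡1+r = proj₂ (length≥4 noK3)

    x≁u⁺ : ¬ Adj G x (at (3 + q))
    x≁u⁺ xu⁺ = noBridge₁ longest (singlePath x∉C) (2 + q) ux xu⁺
    x≁u⁻ : ¬ Adj G x (at (1 + q))
    x≁u⁻ xu⁻ = noBridge₁ longest (singlePath x∉C) (1 + q) (sym G xu⁻) xu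
    y≁u⁺ : ¬ Adj G y (at (3 + q))
    y≁u⁺ yu⁺ = noBridge₁ longest xy-path (2 + q) ux yu⁺
    y≁u⁻ : ¬ Adj G y (at (1 + q))
    y≁u⁻ yu⁻ = noBridge₁ longest yx-path (1 + q) (sym G yu⁻) xu
    y≁u⁺² : ¬ Adj G y (at (4 + q))
    y≁u⁺² yu⁺² = noBridge₂ longest m≡1+r xy-path (2 + q) ux yu⁺²
    y≁u⁻² : ¬ Adj G y (at q)
    y≁u⁻² yu⁻² = noBridge₂ longest m≡1+r yx-path q (sym G yu⁻²) xu

outsideNeighbour : ∀ {G} {C : Cycle G} {x y} → y ≢ x → InComponentOf C x y →
  ∃ λ z → Adj G x z × ¬ OnCycle C z
outsideNeighbour y≢x (here _) = ⊥-elim (y≢x refl)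
outsideNeighbour _ (step _ xz (here z∉C)) = _ , xz , z∉C
outsideNeighbour _ (step _ xz (step z∉C _ _)) = _ , xz , z∉C

relabel : ∀ {G} {x a a' b b' d d' e e' : Vertex G} → a ≡ a' → b ≡ b' → d ≡ d' → e ≡ e' →
  (Adj G a b ⊎ Adj G a x) × (Adj G d e ⊎ Adj G d x) →
  (Adj G a' b' ⊎ Adj G a' x) × (Adj G d' e' ⊎ Adj G d' x)
relabel refl refl refl refl both = both

private
  centre≡ : ∀ t m → 2 + (t + (1 + m)) ≡ t + (3 + m)
  centre≡ = solve-∀
  succ²≡ : ∀ t m → 4 + (t + (1 + m)) ≡ (t + 2) + (3 + m)
  succ²≡ = solve-∀
  succ≡ : ∀ t m → 3 + (t + (1 + m)) ≡ (t + 1) + (3 + m)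
  succ≡ = solve-∀
  pred≡ : ∀ t m → 1 + (t + (1 + m)) ≡ t + 1 * (2 + m)
  pred≡ = solve-∀
  pred²≡ : ∀ t m → t + 2 * (2 + m) ≡ (t + (1 + m)) + (3 + m)
  pred²≡ = solve-∀

-- Main theorem: place u = vtx C i at position 2 + q of the window and read
-- u^{±1}, u^{±2} off the window lemma.
lemma4 : (G : Graph) → TwoConnected G → (C : Cycle G) → LongestCycle C →
    (x : Vertex G) → ¬ OnCycle C x →
    (i : Fin (3 + m C)) → Adj G x (vtx C i) →
    K13FreeK3Free G →
    (∃ λ y → y ≢ x × InComponentOf C x y) →
    ((Adj G (succ^ C i 2) (pred^ C i 1) ⊎ Adj G (succ^ C i 2) x) ×
    (Adj G (pred^ C i 2) (succ^ C i 1) ⊎ Adj G (pred^ C i 2) x))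
lemma4 G _ C longest x x∉C i xu free (y , y≢x , y∈H) =
  relabel {G}
    (at-periodic (t + 2) (4 + q) (succ²≡ t (m C)))
    (cong at (pred≡ t (m C)))
    (≡-sym (at-periodic q (t + 2 * (2 + m C)) (pred²≡ t (m C))))
    (at-periodic (t + 1) (3 + q) (succ≡ t (m C)))
    (window free longest x∉C z∉C xz q (subst (Adj G x) (≡-sym u≡) xu))
  where
  open CycleSequence C
  t = toℕ i
  q = t + (1 + m C)
  neighbour = outsideNeighbour {C = C} y≢x y∈H
  xz = proj₁ (proj₂ neighbour)
  z∉C = proj₂ (proj₂ neighbour)
  u≡ : at (2 + q) ≡ vtx C i
  u≡ = trans (at-periodic t (2 + q) (centre≡ t (m C))) (at-toℕ i)
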